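{- Let $k\ge 4$ be an even integer and let $n\ge k$ be a multiple of $k/2$. Let $\Psi_0$ be the formula defined below and let $\sigma^+$ be the all-$\mathsf{TRUE}$ assignment. If $\sigma\ne\sigma^+$ satisfies $\Psi_0$, then for all $\ell\in\{0,1,\dots,2n/k-1\}$, $\sigma$ assigns at least one variable in $C_{\ell k/2}\cup C_{(\ell+1)k/2}$ to $\mathsf{FALSE}$, and $\sigma$ has at least $2n/k$ variables set to $\mathsf{FALSE}$ in total.
   Context: Let $N=\{0,\dots,n-1\}$ and consider Boolean variables $x_0,\dots,x_{n-1}$. For $i\in\mathbb{N}$ let $\Xi_i=\{i+j \pmod n : j\in\{0,\dots,k/2-1\}\}$ and $C_i=\{x_\ell:\ell\in\Xi_i\}$. For $\ell\in\Xi_i$, $W_{i,\ell}$ is the clause of length $k/2$ on variable set $C_i$ in which $x_\ell$ appears positively and all other variables of $C_i$ appear negated; $\Pi_i$ is the clause of length $k/2$ on variable set $C_i$ in which all variables appear negated. Then $\Psi_0:=\bigwedge_{i\in N,\ \ell\in\Xi_i}(W_{i,\ell}\vee\Pi_{i+k/2})$, a CNF formula whose clauses are the disjunctions $W_{i,\ell}\vee\Pi_{i+k/2}$. -}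

module Defs where

open import Data.Nat using (ℕ; _+_; _*_; _≟_; NonZero)
open import Data.Nat.DivMod using (_%_; m%n<n)
open import Data.Bool using (Bool; true; false)
open import Data.Fin using (Fin; fromℕ<)
open import Data.List using (List; []; _∷_; map; upTo; concatMap; _++_; length; filter; allFin)
open import Data.List.Relation.Unary.Any using (Any)
open import Data.List.Relation.Unary.All using (All)
open import Data.Product using (_×_; _,_)
open import Relation.Nullary.Decidable using (does)
open import Relation.Binary.PropositionalEquality using (_≡_)
import Data.Bool.Properties as BP

Assignment : ℕ → Set
Assignment n = Fin n → Bool

-- A literal: (variable index, polarity); polarity true = positive, false = negated.
Literal : Set
Literal = ℕ × Bool

Clause : Set
Clause = List Literal

CNF : Set
CNF = List Clause

module _ (n : ℕ) .{{_ : NonZero n}} where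

  var : ℕ → Fin n
  var m = fromℕ< (m%n<n m n)

  litSat : Assignment n → Literal → Set
  litSat σ (v , b) = σ (var v) ≡ b

  clauseSat : Assignment n → Clause → Set
  clauseSat σ c = Any (litSat σ) c

  Satisfies : Assignment n → CNF → Set
  Satisfies σ φ = All (clauseSat σ) φ

  -- h plays the role of k/2.
  -- Ξ_i = { i + j mod n : j ∈ {0,…,h-1} }
  Ξ : (h i : ℕ) → List ℕ
  Ξ h i = map (λ j → (i + j) % n) (upTo h)

  W : (h i ℓ : ℕ) → Clause
  W h i ℓ = map (λ v → (v , does (v ≟ ℓ))) (Ξ h i)

  Π : (h i : ℕ) → Clause
  Π h i = map (λ v → (v , false)) (Ξ h i)

  Ψ₀ : (h : ℕ) → CNF
  Ψ₀ h = concatMap (λ i → map (λ ℓ → W h i ℓ ++ Π h (i + h)) (Ξ h i)) (upTo n)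

  SomeFalseIn : Assignment n → List ℕ → Set
  SomeFalseIn σ vs = Any (λ v → σ (var v) ≡ false) vs

  numFalse : Assignment n → ℕ
  numFalse σ = length (filter (λ x → σ x BP.≟ false) (allFin n))

-- Write h = k/2.  A clause W_{i,ℓ} ∨ Π_{i+h} says: if the block C_{i+h} is all TRUE, then
-- C_i is not "all TRUE except x_ℓ".  Consequently a window of 2h consecutive TRUE variables
-- can be slid one step to the left, hence around the whole cycle, so σ ≠ σ⁺ puts a FALSE
-- variable in every window C_{ℓh} ∪ C_{(ℓ+1)h}.  Cutting the cycle into the n/h blocks
-- C_{jh}, a block with at most one FALSE variable is followed by a block with at least one;
-- so every block without FALSE variables is preceded by one with at least two, and summing
-- this around the cycle shows that there are at least n/h FALSE variables.
module Submission where

open import Defs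
open import Data.Bool using (Bool; true; false)
import Data.Bool.Properties as Bool
open import Data.Fin using (Fin; toℕ)
import Data.Fin as Fin
open import Data.Fin.Properties using (toℕ-injective; toℕ-fromℕ<; toℕ<n)
open import Data.List using (List; _∷_; _++_; filter; length; tabulate)
open import Data.List.Membership.Propositional using (find; lose)
open import Data.List.Membership.Propositional.Properties using (∈-upTo⁺; ∈-upTo⁻)
open import Data.List.Relation.Unary.All using () renaming (lookup to All-lookup)
import Data.List.Relation.Unary.All.Properties as All
open import Data.List.Relation.Unary.Any using (Any)
import Data.List.Relation.Unary.Any.Properties as Any
open import Data.Nat using (ℕ; zero; suc; _+_; _*_; _∸_; _≤_; _<_; _≤?_; _≟_; z≤n; s≤s; NonZero; >-nonZero⁻¹; pred)
open import Data.Nat.DivMod using (_/_; _%_; m%n<n; m%n%n≡m%n; [m+n]%n≡m%n; %-distribˡ-+; m<n⇒m%n≡m; m*n/n≡m)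
open import Data.Nat.Divisibility using (_∣_; quotient; m∣n⇒n≡quotient*m)
open import Data.Nat.Properties
open import Algebra.Properties.CommutativeSemigroup +-commutativeSemigroup using (x∙yz≈xz∙y; xy∙z≈xz∙y)
open import Data.Product using (_×_; _,_; ∃-syntax)
open import Function using (_∘_)
open import Data.Sum using (_⊎_; inj₁; inj₂)
open import Relation.Binary.PropositionalEquality
open import Relation.Nullary using (¬_; yes; no; does; contradiction)
open import Relation.Nullary.Decidable using (dec-true; dec-false)

sumBelow : (ℕ → ℕ) → ℕ → ℕ
sumBelow f zero    = 0
sumBelow f (suc q) = sumBelow f q + f q

potential-bound : (f z : ℕ → ℕ) → (∀ j → 1 + z (suc j) ≤ f j + z j) →
                  ∀ q → q + z q ≤ sumBelow f q + z 0
potential-bound f z step zero    = ≤-refl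
potential-bound f z step (suc q) = begin
  suc q + z (suc q)          ≡⟨ +-suc q (z (suc q)) ⟨
  q + (1 + z (suc q))        ≤⟨ +-monoʳ-≤ q (step q) ⟩
  q + (f q + z q)            ≡⟨ x∙yz≈xz∙y q (f q) (z q) ⟩
  q + z q + f q              ≤⟨ +-monoˡ-≤ (f q) (potential-bound f z step q) ⟩
  sumBelow f q + z 0 + f q   ≡⟨ xy∙z≈xz∙y (sumBelow f q) (z 0) (f q) ⟩
  sumBelow f (suc q) + z 0   ∎
  where open ≤-Reasoning

cyclic-potential-bound : (f z : ℕ → ℕ) → (∀ j → 1 + z (suc j) ≤ f j + z j) →
                         ∀ q → z q ≡ z 0 → q ≤ sumBelow f q
cyclic-potential-bound f z step q zq≡z0 =
  +-cancelʳ-≤ (z 0) q (sumBelow f q) (subst (λ w → q + w ≤ sumBelow f q + z 0) zq≡z0 (potential-bound f z step q))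

-- 1 ∸ b is the indicator of b ≡ 0, used as the potential z in cyclic-potential-bound.
deficit-step : ∀ a b → (a ≡ 0 → b ≢ 0) → (a ≡ 1 → b ≢ 0) → 1 + (1 ∸ b) ≤ a + (1 ∸ a)
deficit-step zero          zero    after0 _      = contradiction refl (after0 refl)
deficit-step zero          (suc b) _      _      = s≤s (m∸n≤m 0 b)
deficit-step (suc zero)    zero    _      after1 = contradiction refl (after1 refl)
deficit-step (suc zero)    (suc b) _      _      = s≤s (m∸n≤m 0 b)
deficit-step (suc (suc a)) b       _      _      = s≤s (≤-trans (m∸n≤m 1 b) (s≤s z≤n))

falseCount : Bool → ℕ
falseCount true  = 0
falseCount false = 1

falseCount≡0⇒true : ∀ {b} → falseCount b ≡ 0 → b ≡ true
falseCount≡0⇒true {true} refl = refl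

length-filter-false-∷ : ∀ {A : Set} (g : A → Bool) x (xs : List A) →
  length (filter (λ y → g y Bool.≟ false) (x ∷ xs)) ≡ falseCount (g x) + length (filter (λ y → g y Bool.≟ false) xs)
length-filter-false-∷ g x xs with g x
... | true  = refl
... | false = refl

module _ (s : ℕ → Bool) where

  TrueOn : ℕ → ℕ → Set
  TrueOn a L = ∀ t → t < L → s (a + t) ≡ true

  FalseIn : ℕ → ℕ → Set
  FalseIn a L = ∃[ t ] t < L × s (a + t) ≡ false

  falses : ℕ → ℕ → ℕ
  falses a zero    = 0
  falses a (suc L) = falseCount (s a) + falses (suc a) L

  FalseIn-or-TrueOn : ∀ a L → FalseIn a L ⊎ TrueOn a L
  FalseIn-or-TrueOn a L with anyUpTo? (λ t → s (a + t) Bool.≟ false) L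
  ... | yes found = inj₁ found
  ... | no none   = inj₂ λ t t<L → Bool.¬-not λ e → none (t , t<L , e)

  FalseIn-+ : ∀ a x y → FalseIn a (x + y) → FalseIn a x ⊎ FalseIn (a + x) y
  FalseIn-+ a x y (t , t<x+y , e) with x ≤? t
  ... | no  x≰t = inj₁ (t , ≰⇒> x≰t , e)
  ... | yes x≤t with m≤n⇒∃[o]m+o≡n x≤t
  ...   | o , refl = inj₂ (o , +-cancelˡ-< x o y t<x+y , subst (λ v → s v ≡ false) (sym (+-assoc a x o)) e)

  falses-+ : ∀ a x y → falses a (x + y) ≡ falses a x + falses (a + x) y
  falses-+ a zero    y = cong (λ b → falses b y) (sym (+-identityʳ a))
  falses-+ a (suc x) y = begin
    falseCount (s a) + falses (suc a) (x + y)                        ≡⟨ cong (falseCount (s a) +_) (falses-+ (suc a) x y) ⟩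
    falseCount (s a) + (falses (suc a) x + falses (suc a + x) y)     ≡⟨ +-assoc (falseCount (s a)) _ _ ⟨
    falseCount (s a) + falses (suc a) x + falses (suc a + x) y       ≡⟨ cong (λ b → falseCount (s a) + falses (suc a) x + falses b y) (+-suc a x) ⟨
    falseCount (s a) + falses (suc a) x + falses (a + suc x) y       ∎
    where open ≡-Reasoning

  falses-blocks : ∀ h q → falses 0 (q * h) ≡ sumBelow (λ j → falses (j * h) h) q
  falses-blocks h zero    = refl
  falses-blocks h (suc q) = begin
    falses 0 (h + q * h)                   ≡⟨ cong (falses 0) (+-comm h (q * h)) ⟩
    falses 0 (q * h + h)                   ≡⟨ falses-+ 0 (q * h) h ⟩
    falses 0 (q * h) + falses (q * h) h    ≡⟨ cong (_+ falses (q * h) h) (falses-blocks h q) ⟩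
    sumBelow (λ j → falses (j * h) h) (suc q) ∎
    where open ≡-Reasoning

  falses≡0⇒TrueOn : ∀ a L → falses a L ≡ 0 → TrueOn a L
  falses≡0⇒TrueOn a (suc L) none zero    _         =
    subst (λ v → s v ≡ true) (sym (+-identityʳ a)) (falseCount≡0⇒true (m+n≡0⇒m≡0 _ none))
  falses≡0⇒TrueOn a (suc L) none (suc t) (s≤s t<L) =
    subst (λ v → s v ≡ true) (sym (+-suc a t)) (falses≡0⇒TrueOn (suc a) L (m+n≡0⇒n≡0 _ none) t t<L)

  FalseIn⇒falses≢0 : ∀ a L → FalseIn a L → falses a L ≢ 0
  FalseIn⇒falses≢0 a L (t , t<L , e) none = contradiction (trans (sym e) (falses≡0⇒TrueOn a L none t t<L)) λ ()

  falses≡1⇒unique-false : ∀ a L → falses a L ≡ 1 →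
    ∃[ t ] t < L × s (a + t) ≡ false × (∀ t′ → t′ < L → t′ ≢ t → s (a + t′) ≡ true)
  falses≡1⇒unique-false a (suc L) one with s a in sa
  ... | true with falses≡1⇒unique-false (suc a) L one
  ...   | t , t<L , e , others = suc t , s≤s t<L , subst (λ v → s v ≡ false) (sym (+-suc a t)) e , others′
    where
      others′ : ∀ t′ → t′ < suc L → t′ ≢ suc t → s (a + t′) ≡ true
      others′ zero     _           _    = subst (λ v → s v ≡ true) (sym (+-identityʳ a)) sa
      others′ (suc u) (s≤s u<L) u≢t = subst (λ v → s v ≡ true) (sym (+-suc a u)) (others u u<L (u≢t ∘ cong suc))
  falses≡1⇒unique-false a (suc L) one | false =
    0 , s≤s z≤n , subst (λ v → s v ≡ false) (sym (+-identityʳ a)) sa , others′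
    where
      others′ : ∀ t′ → t′ < suc L → t′ ≢ 0 → s (a + t′) ≡ true
      others′ zero    _         0≢0 = contradiction refl 0≢0
      others′ (suc u) (s≤s u<L) _   =
        subst (λ v → s v ≡ true) (sym (+-suc a u)) (falses≡0⇒TrueOn (suc a) L (suc-injective one) u u<L)

  falses-cong : ∀ a b L → (∀ t → s (a + t) ≡ s (b + t)) → falses a L ≡ falses b L
  falses-cong a b zero    eq = refl
  falses-cong a b (suc L) eq = cong₂ _+_
    (cong falseCount (subst₂ (λ u v → s u ≡ s v) (+-identityʳ a) (+-identityʳ b) (eq 0)))
    (falses-cong (suc a) (suc b) L λ t → subst₂ (λ u v → s u ≡ s v) (+-suc a t) (+-suc b t) (eq (suc t)))

  length-filter-false-tabulate : ∀ {A : Set} (g : A → Bool) m (f : Fin m → A) a →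
    (∀ i → g (f i) ≡ s (a + toℕ i)) →
    length (filter (λ x → g x Bool.≟ false) (tabulate f)) ≡ falses a m
  length-filter-false-tabulate g zero    f a gf = refl
  length-filter-false-tabulate g (suc m) f a gf = begin
    length (filter (λ x → g x Bool.≟ false) (tabulate f))       ≡⟨ length-filter-false-∷ g (f Fin.zero) _ ⟩
    falseCount (g (f Fin.zero)) + _                              ≡⟨ cong₂ _+_ (cong falseCount head) tail ⟩
    falses a (suc m)                                             ∎
    where
      open ≡-Reasoning
      head : g (f Fin.zero) ≡ s a
      head = trans (gf Fin.zero) (cong s (+-identityʳ a))
      tail : length (filter (λ x → g x Bool.≟ false) (tabulate (f ∘ Fin.suc))) ≡ falses (suc a) m
      tail = length-filter-false-tabulate g m (f ∘ Fin.suc) (suc a) λ i → trans (gf (Fin.suc i)) (cong s (+-suc a (toℕ i)))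

[m%n+k]%n≡[m+k]%n : ∀ m k n .{{_ : NonZero n}} → (m % n + k) % n ≡ (m + k) % n
[m%n+k]%n≡[m+k]%n m k n = begin
  (m % n + k) % n          ≡⟨ %-distribˡ-+ (m % n) k n ⟩
  (m % n % n + k % n) % n  ≡⟨ cong (λ r → (r + k % n) % n) (m%n%n≡m%n m n) ⟩
  (m % n + k % n) % n      ≡⟨ %-distribˡ-+ m k n ⟨
  (m + k) % n              ∎
  where open ≡-Reasoning

module _ {n : ℕ} .{{_ : NonZero n}} where

  toℕ-var : ∀ v → toℕ (var n v) ≡ v % n
  toℕ-var v = toℕ-fromℕ< (m%n<n v n)

  var-cong : ∀ {a b} → a % n ≡ b % n → var n a ≡ var n b
  var-cong eq = toℕ-injective (trans (toℕ-var _) (trans eq (sym (toℕ-var _))))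

  var-toℕ : ∀ (x : Fin n) → var n (toℕ x) ≡ x
  var-toℕ x = toℕ-injective (trans (toℕ-var (toℕ x)) (m<n⇒m%n≡m (toℕ<n x)))

  Any-Ξ⁻ : ∀ {P : ℕ → Set} {h i} → Any P (Ξ n h i) → ∃[ j ] j < h × P ((i + j) % n)
  Any-Ξ⁻ p with find (Any.map⁻ p)
  ... | j , j∈upTo , pj = j , ∈-upTo⁻ j∈upTo , pj

  Any-Ξ⁺ : ∀ {P : ℕ → Set} {h i j} → j < h → P ((i + j) % n) → Any P (Ξ n h i)
  Any-Ξ⁺ j<h pj = Any.map⁺ (lose (∈-upTo⁺ j<h) pj)

module _ {n : ℕ} .{{_ : NonZero n}} (σ : Assignment n) where

  value : ℕ → Bool
  value v = σ (var n v)

  value-mod : ∀ v → value (v % n) ≡ value v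
  value-mod v = cong σ (var-cong (m%n%n≡m%n v n))

  value-mod-+ : ∀ i k → value ((i % n + k) % n) ≡ value (i + k)
  value-mod-+ i k = trans (value-mod (i % n + k)) (cong σ (var-cong ([m%n+k]%n≡[m+k]%n i k n)))

  value-periodic : ∀ v → value (n + v) ≡ value v
  value-periodic v = cong σ (var-cong (trans (cong (_% n) (+-comm n v)) ([m+n]%n≡m%n v n)))

  numFalse≡falses : numFalse n σ ≡ falses value 0 n
  numFalse≡falses = length-filter-false-tabulate value σ n (λ x → x) 0 λ x → cong σ (sym (var-toℕ x))

  FalseIn⇒SomeFalseIn : ∀ h i → FalseIn value i h → SomeFalseIn n σ (Ξ n h i)
  FalseIn⇒SomeFalseIn h i (t , t<h , e) = Any-Ξ⁺ t<h (trans (value-mod (i + t)) e)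

module _ {n : ℕ} .{{_ : NonZero n}} (σ : Assignment n) (h : ℕ) .{{_ : NonZero h}}
         (sat : Satisfies n σ (Ψ₀ n h)) where

  Ψ₀-clause : ∀ {i j} → i < n → j < h → clauseSat n σ (W n h i ((i + j) % n) ++ Π n h (i + h))
  Ψ₀-clause i<n j<h =
    All-lookup (All.map⁻ (All.map⁻ (All-lookup (All.map⁻ (All.concat⁻ sat)) (∈-upTo⁺ i<n)))) (∈-upTo⁺ j<h)

  Ψ₀-forces-true : ∀ i j → j < h → TrueOn (value σ) (i + h) h →
                   (∀ j′ → j′ < h → j′ ≢ j → value σ (i + j′) ≡ true) → value σ (i + j) ≡ true
  Ψ₀-forces-true i j j<h next others with Any.++⁻ (W n h (i % n) ((i % n + j) % n)) (Ψ₀-clause {i % n} (m%n<n i n) j<h)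
  ... | inj₁ w with Any-Ξ⁻ (Any.map⁻ w)
  ...   | j′ , j′<h , e with (i % n + j′) % n ≟ (i % n + j) % n
  ...     | yes same = begin
    value σ (i + j)                 ≡⟨ value-mod-+ σ i j ⟨
    value σ ((i % n + j) % n)       ≡⟨ cong (value σ) same ⟨
    value σ ((i % n + j′) % n)      ≡⟨ e ⟩
    does ((i % n + j′) % n ≟ _)     ≡⟨ dec-true (_ ≟ _) same ⟩
    true                            ∎
    where open ≡-Reasoning
  ...     | no differ = contradiction (trans (sym true′) false′) λ ()
    where
      true′ : value σ (i + j′) ≡ true
      true′ = others j′ j′<h λ { refl → differ refl }
      false′ : value σ (i + j′) ≡ false
      false′ = trans (sym (value-mod-+ σ i j′)) (trans e (dec-false (_ ≟ _) differ))
  Ψ₀-forces-true i j j<h next others | inj₂ p with Any-Ξ⁻ (Any.map⁻ p)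
  ... | j′ , j′<h , e = contradiction (trans (sym e) reduce) λ ()
    where
      reduce : value σ ((i % n + h + j′) % n) ≡ true
      reduce = begin
        value σ ((i % n + h + j′) % n)    ≡⟨ cong (λ v → value σ (v % n)) (+-assoc (i % n) h j′) ⟩
        value σ ((i % n + (h + j′)) % n)  ≡⟨ value-mod-+ σ i (h + j′) ⟩
        value σ (i + (h + j′))            ≡⟨ cong (value σ) (+-assoc i h j′) ⟨
        value σ (i + h + j′)              ≡⟨ next j′ j′<h ⟩
        true                              ∎
        where open ≡-Reasoning

  window-slide : ∀ a → TrueOn (value σ) (suc a) (h + h) → TrueOn (value σ) a (h + h)
  window-slide a window zero    _     = Ψ₀-forces-true a 0 (>-nonZero⁻¹ h) next others
    where
      next : TrueOn (value σ) (a + h) h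
      next j′ j′<h = subst (λ v → value σ v ≡ true) (sym shift) (window (pred h + j′) (+-mono-≤-< pred[n]≤n j′<h))
        where
          shift : a + h + j′ ≡ suc a + (pred h + j′)
          shift = begin
            a + h + j′                ≡⟨ +-assoc a h j′ ⟩
            a + (h + j′)              ≡⟨ cong (λ m → a + (m + j′)) (suc-pred h) ⟨
            a + suc (pred h + j′)     ≡⟨ +-suc a (pred h + j′) ⟩
            suc a + (pred h + j′)     ∎
            where open ≡-Reasoning
      others : ∀ j′ → j′ < h → j′ ≢ 0 → value σ (a + j′) ≡ true
      others zero    _     0≢0 = contradiction refl 0≢0
      others (suc u) u<h   _   =
        subst (λ v → value σ v ≡ true) (sym (+-suc a u)) (window u (<-≤-trans (<⇒≤ u<h) (m≤m+n h h)))
  window-slide a window (suc t) t<2h  =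
    subst (λ v → value σ v ≡ true) (sym (+-suc a t)) (window t (<⇒≤ t<2h))

  window-descend : ∀ d a → TrueOn (value σ) (d + a) (h + h) → TrueOn (value σ) a (h + h)
  window-descend zero    a window = window
  window-descend (suc d) a window = window-descend d a (window-slide (d + a) window)

  true-window⇒all-true : ∀ a → TrueOn (value σ) a (h + h) → ∀ x → σ x ≡ true
  -- Shift the window forward by the period n, past x, then slide it back to start at x.
  true-window⇒all-true a window x =
    trans (cong σ (trans (sym (var-toℕ x)) (cong (var n) (sym (+-identityʳ (toℕ x))))))
          (window-descend (n + a ∸ toℕ x) (toℕ x) shifted 0 (<-≤-trans (>-nonZero⁻¹ h) (m≤m+n h h)))
    where
      periodic : TrueOn (value σ) (n + a) (h + h)
      periodic t t<2h = trans (cong (value σ) (+-assoc n a t)) (trans (value-periodic σ (a + t)) (window t t<2h))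
      shifted : TrueOn (value σ) (n + a ∸ toℕ x + toℕ x) (h + h)
      shifted = subst (λ b → TrueOn (value σ) b (h + h))
                      (sym (m∸n+n≡m (≤-trans (<⇒≤ (toℕ<n x)) (m≤m+n n a)))) periodic

  block : ℕ → ℕ
  block j = falses (value σ) (j * h) h

  window-halves : ∀ j → FalseIn (value σ) (j * h) (h + h) →
                  FalseIn (value σ) (j * h) h ⊎ FalseIn (value σ) (suc j * h) h
  window-halves j found with FalseIn-+ (value σ) (j * h) h h found
  ... | inj₁ first  = inj₁ first
  ... | inj₂ second = inj₂ (subst (λ a → FalseIn (value σ) a h) (+-comm (j * h) h) second)

  singleton-block⇒next-nonempty : ∀ j → block j ≡ 1 → block (suc j) ≢ 0
  singleton-block⇒next-nonempty j one none with falses≡1⇒unique-false (value σ) (j * h) h one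
  ... | t , t<h , false′ , others = contradiction (trans (sym false′) true′) λ ()
    where
      next : TrueOn (value σ) (j * h + h) h
      next = subst (λ a → TrueOn (value σ) a h) (+-comm h (j * h)) (falses≡0⇒TrueOn (value σ) (suc j * h) h none)
      true′ : value σ (j * h + t) ≡ true
      true′ = Ψ₀-forces-true (j * h) t t<h next others

  module _ (σ≢σ⁺ : ¬ (∀ x → σ x ≡ true)) where

    window-has-false : ∀ a → FalseIn (value σ) a (h + h)
    window-has-false a with FalseIn-or-TrueOn (value σ) a (h + h)
    ... | inj₁ found  = found
    ... | inj₂ window = contradiction (true-window⇒all-true a window) σ≢σ⁺

    empty-block⇒next-nonempty : ∀ j → block j ≡ 0 → block (suc j) ≢ 0
    empty-block⇒next-nonempty j none with window-halves j (window-has-false (j * h))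
    ... | inj₁ first  = λ _ → FalseIn⇒falses≢0 (value σ) (j * h) h first none
    ... | inj₂ second = FalseIn⇒falses≢0 (value σ) (suc j * h) h second

    window-pair-has-false : ∀ ℓ → SomeFalseIn n σ (Ξ n h (ℓ * h) ++ Ξ n h (suc ℓ * h))
    window-pair-has-false ℓ with window-halves ℓ (window-has-false (ℓ * h))
    ... | inj₁ first  = Any.++⁺ˡ (FalseIn⇒SomeFalseIn σ h (ℓ * h) first)
    ... | inj₂ second = Any.++⁺ʳ (Ξ n h (ℓ * h)) (FalseIn⇒SomeFalseIn σ h (suc ℓ * h) second)

    numFalse-≥ : h ∣ n → n / h ≤ numFalse n σ
    numFalse-≥ h∣n = begin
      n / h                         ≡⟨ cong (_/ h) n≡q*h ⟩
      q * h / h                     ≡⟨ m*n/n≡m q h ⟩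
      q                             ≤⟨ cyclic-potential-bound block (λ j → 1 ∸ block j) deficit q (cong (1 ∸_) block-q≡block-0) ⟩
      sumBelow block q              ≡⟨ falses-blocks (value σ) h q ⟨
      falses (value σ) 0 (q * h)    ≡⟨ cong (falses (value σ) 0) n≡q*h ⟨
      falses (value σ) 0 n          ≡⟨ numFalse≡falses σ ⟨
      numFalse n σ                  ∎
      where
        open ≤-Reasoning
        q : ℕ
        q = quotient h∣n
        n≡q*h : n ≡ q * h
        n≡q*h = m∣n⇒n≡quotient*m h∣n
        block-q≡block-0 : block q ≡ block 0
        block-q≡block-0 = trans (cong (λ a → falses (value σ) a h) (sym n≡q*h)) (falses-cong (value σ) n 0 h (value-periodic σ))
        deficit : ∀ j → 1 + (1 ∸ block (suc j)) ≤ block j + (1 ∸ block j)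
        deficit j = deficit-step (block j) (block (suc j)) (empty-block⇒next-nonempty j) (singleton-block⇒next-nonempty j)

lemma3p2 : (k n : ℕ) → 2 ∣ k → 4 ≤ k → .{{_ : NonZero (k / 2)}} → (k / 2) ∣ n → k ≤ n → .{{_ : NonZero n}}
    → (σ : Assignment n) → ¬ (∀ x → σ x ≡ true) → Satisfies n σ (Ψ₀ n (k / 2))
    → (∀ ℓ → ℓ < n / (k / 2) → SomeFalseIn n σ (Ξ n (k / 2) (ℓ * (k / 2)) ++ Ξ n (k / 2) (suc ℓ * (k / 2))))
      × (n / (k / 2) ≤ numFalse n σ)
lemma3p2 k n _ _ h∣n _ σ σ≢σ⁺ sat =
  (λ ℓ _ → window-pair-has-false σ (k / 2) sat σ≢σ⁺ ℓ) , numFalse-≥ σ (k / 2) sat σ≢σ⁺ h∣n
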